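{- Let $\Gamma$ be a reduced nonbipartite graph of diameter $2$ which contains no triangles. Then $\Gamma$ is stable.
   Context: Graphs are finite, simple, loopless; reduced means distinct vertices have distinct neighbourhoods. The diameter of a connected graph is the maximum shortest-path distance between two vertices. The canonical double cover $\mathrm{B}\Gamma=\Gamma\times K_2$ has vertex set $V\times\{0,1\}$ with $(u,i)\sim(v,j)$ iff $(u,v)\in E$ and $i\ne j$. $\Gamma$ is stable if $\mathrm{Aut}(\mathrm{B}\Gamma)\cong\mathrm{Aut}(\Gamma)\times\mathbb{Z}_2$. -}

module Defs where

open import Data.Nat using (ℕ; zero; suc; _≤_)
open import Data.Fin using (Fin)
open import Data.Bool using (Bool; true; false; _∧_; _xor_)
open import Data.Bool.Properties using (∧-zeroˡ)
open import Data.Product using (Σ; ∃; ∃-syntax; _×_; _,_; proj₁; proj₂)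
open import Data.Empty using (⊥)
open import Relation.Nullary using (¬_)
open import Relation.Binary.PropositionalEquality using (_≡_; _≢_; refl; cong₂)

record Graph (V : Set) : Set where
  field
    adj    : V → V → Bool
    adj-sym    : ∀ u v → adj u v ≡ adj v u
    adj-irrefl : ∀ u → adj u u ≡ false
open Graph public

Adj : {V : Set} → Graph V → V → V → Set
Adj G u v = adj G u v ≡ true

Reduced : {V : Set} → Graph V → Set
Reduced {V} G = ∀ u v → (∀ w → adj G u w ≡ adj G v w) → u ≡ v

data Walk {V : Set} (G : Graph V) : V → V → ℕ → Set where
  here : ∀ u → Walk G u u zero
  step : ∀ {u v w k} → Adj G u v → Walk G v w k → Walk G u w (suc k)

DistLe : {V : Set} → Graph V → V → V → ℕ → Set
DistLe G u v k = ∃[ m ] (m ≤ k × Walk G u v m)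

HasDiameter : {V : Set} → Graph V → ℕ → Set
HasDiameter {V} G zero = ∀ (u v : V) → DistLe G u v zero
HasDiameter {V} G (suc d) =
  (∀ (u v : V) → DistLe G u v (suc d)) × (∃[ u ] ∃[ v ] ¬ DistLe G u v d)

TriangleFree : {V : Set} → Graph V → Set
TriangleFree {V} G = ∀ (u v w : V) → Adj G u v → Adj G v w → Adj G u w → ⊥

Bipartite : {V : Set} → Graph V → Set
Bipartite {V} G = Σ (V → Bool) λ c → ∀ (u v : V) → Adj G u v → c u ≢ c v

xor-comm' : ∀ x y → x xor y ≡ y xor x
xor-comm' false false = refl
xor-comm' false true  = refl
xor-comm' true  false = refl
xor-comm' true  true  = refl

xor-self : ∀ x → x xor x ≡ false
xor-self false = refl
xor-self true  = refl

∧-false : ∀ x → x ∧ false ≡ false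
∧-false false = refl
∧-false true  = refl

-- canonical double cover  BΓ = Γ × K₂
B : {V : Set} → Graph V → Graph (V × Bool)
adj (B G) (u , i) (v , j) = adj G u v ∧ (i xor j)
adj-sym (B G) (u , i) (v , j) = cong₂ _∧_ (adj-sym G u v) (xor-comm' i j)
adj-irrefl (B G) (u , i) rewrite adj-irrefl G u = refl

record Aut {V : Set} (G : Graph V) : Set where
  field
    fun   : V → V
    inv   : V → V
    inv-l : ∀ x → inv (fun x) ≡ x
    inv-r : ∀ x → fun (inv x) ≡ x
    pres  : ∀ u v → adj G (fun u) (fun v) ≡ adj G u v
open Aut public

_≈A_ : {V : Set} {G : Graph V} → Aut G → Aut G → Set
_≈A_ {V} σ τ = ∀ (x : V) → fun σ x ≡ fun τ x

_∘A_ : {V : Set} {G : Graph V} → Aut G → Aut G → Aut G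
fun   (σ ∘A τ) x = fun σ (fun τ x)
inv   (σ ∘A τ) x = inv τ (inv σ x)
inv-l (_∘A_ σ τ) x rewrite inv-l σ (fun τ x) = inv-l τ x
inv-r (_∘A_ σ τ) x rewrite inv-r τ (inv σ x) = inv-r σ x
pres  (_∘A_ {G = G} σ τ) u v rewrite pres σ (fun τ u) (fun τ v) = pres τ u v

-- the direct product group Aut(G) × ℤ₂ (ℤ₂ = Bool under xor)
_≈P_ : {V : Set} {G : Graph V} → Aut G × Bool → Aut G × Bool → Set
(σ , a) ≈P (τ , b) = (σ ≈A τ) × (a ≡ b)

_·P_ : {V : Set} {G : Graph V} → Aut G × Bool → Aut G × Bool → Aut G × Bool
(σ , a) ·P (τ , b) = (σ ∘A τ , a xor b)

-- Stable: Aut(BΓ) ≅ Aut(Γ) × ℤ₂ as groups, i.e. there is a group isomorphism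
-- (a well-defined, multiplicative, injective and surjective map).
Stable : {V : Set} → Graph V → Set
Stable {V} G =
  Σ (Aut (B G) → Aut G × Bool) λ Φ →
    (∀ α β → α ≈A β → Φ α ≈P Φ β)
  × (∀ α β → Φ (α ∘A β) ≈P (Φ α ·P Φ β))
  × (∀ α β → Φ α ≈P Φ β → α ≈A β)
  × (∀ p → ∃[ α ] (Φ α ≈P p))

-- Every automorphism α of BΓ preserves or swaps the two layers V × {i} as a whole.
-- The bit "does α change the layer of x" is constant along edges of BΓ, so on one
-- layer it is a colouring of Γ that agrees on non-adjacent vertices (diameter 2
-- gives them a common neighbour); in a triangle-free nonbipartite graph such a
-- colouring is constant. Hence α (u , i) = (σᵢ u , a ⊕ i) where σᵢ, σ₁₋ᵢ carry
-- edges to edges across the layers. Triangle-freeness and diameter 2 then make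
-- each σᵢ an automorphism of Γ, so N(σ₀ u) = N(σ₁ u), and reducedness gives
-- σ₀ = σ₁: α is the lift of (σ₀ , a).

module Submission where

open import Defs
open import Data.Nat using (ℕ; suc; s≤s; z≤n)
open import Data.Fin using (Fin)
open import Data.Bool using (Bool; true; false; not; _∧_; _xor_)
open import Data.Bool.Properties
  using (_≟_; ∧-identityʳ; ∧-conicalʳ; not-involutive; not-distribʳ-xor;
         xor-annihilates-not; xor-inverseʳ; xor-identityʳ; xor-assoc; xor-comm)
open import Data.Product using (∃-syntax; _×_; _,_; proj₁; proj₂)
open import Data.Empty using (⊥-elim)
open import Relation.Nullary using (¬_; yes; no)
open import Relation.Binary.PropositionalEquality
open ≡-Reasoning

xor≡true⇒≡not : ∀ x y → x xor y ≡ true → y ≡ not x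
xor≡true⇒≡not false true  _ = refl
xor≡true⇒≡not true  false _ = refl

xor-cancelˡ : ∀ a x → a xor (a xor x) ≡ x
xor-cancelˡ false x = refl
xor-cancelˡ true  x = not-involutive x

xor-cancel-common : ∀ a i j → (a xor i) xor (a xor j) ≡ i xor j
xor-cancel-common false i j = refl
xor-cancel-common true  i j = xor-annihilates-not i j

∘A-cong : ∀ {V : Set} {G : Graph V} {α α′ β β′ : Aut G} →
          α ≈A α′ → β ≈A β′ → (α ∘A β) ≈A (α′ ∘A β′)
∘A-cong {α′ = α′} α≈α′ β≈β′ x = trans (α≈α′ _) (cong (fun α′) (β≈β′ x))

module _ {V : Set} {G : Graph V} where

  Adj-sym : ∀ {u v} → Adj G u v → Adj G v u
  Adj-sym {u} {v} u~v = trans (adj-sym G v u) u~v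

  common-neighbour : (∀ u v → DistLe G u v 2) → ∀ {u v} → u ≢ v → adj G u v ≡ false →
                     ∃[ w ] (Adj G u w × Adj G w v)
  common-neighbour dist≤2 {u} {v} u≢v u≁v with dist≤2 u v
  ... | 0 , _ , here _ = ⊥-elim (u≢v refl)
  ... | 2 , _ , step u~w (step w~v (here _)) = _ , u~w , w~v
  ... | suc (suc (suc _)) , s≤s (s≤s ()) , _
  ... | 1 , _ , step u~v (here _) with trans (sym u~v) u≁v
  ...   | ()

  has-neighbour : HasDiameter G 2 → ∀ u → ∃[ v ] Adj G u v
  has-neighbour (dist≤2 , p , q , p↮q) u with dist≤2 u p | dist≤2 u q
  ... | _ , _ , step u~v _ | _ = _ , u~v
  ... | _ , _ , here _ | _ , _ , step u~v _ = _ , u~v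
  ... | _ , _ , here _ | _ , _ , here _ = ⊥-elim (p↮q (0 , z≤n , here u))

  -- Otherwise differently coloured vertices are adjacent, so a monochromatic edge
  -- would form a triangle with a vertex of the other colour: c is a 2-colouring.
  nonEdge-invariant⇒constant : TriangleFree G → ¬ Bipartite G → (c : V → Bool) →
                               (∀ u v → u ≢ v → adj G u v ≡ false → c u ≡ c v) →
                               ∀ u v → c u ≡ c v
  nonEdge-invariant⇒constant tf nbip c c-inv u w with c u ≟ c w
  ... | yes cu≡cw = cu≡cw
  ... | no cu≢cw = ⊥-elim (nbip (c , proper))
    where
      differently-coloured⇒adjacent : ∀ x y → c x ≢ c y → Adj G x y
      differently-coloured⇒adjacent x y cx≢cy with adj G x y in x≁y
      ... | true  = refl
      ... | false = ⊥-elim (cx≢cy (c-inv x y (λ x≡y → cx≢cy (cong c x≡y)) x≁y))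

      other-colour : ∀ x → ∃[ z ] c x ≢ c z
      other-colour x with c u ≟ c x
      ... | yes cu≡cx = w , λ cx≡cw → cu≢cw (trans cu≡cx cx≡cw)
      ... | no cu≢cx = u , ≢-sym cu≢cx

      proper : ∀ x y → Adj G x y → c x ≢ c y
      proper x y x~y cx≡cy with other-colour x
      ... | z , cx≢cz =
        tf x y z x~y
          (differently-coloured⇒adjacent y z (λ cy≡cz → cx≢cz (trans cx≡cy cy≡cz)))
          (differently-coloured⇒adjacent x z cx≢cz)

  adj-B-opposite : ∀ u v i → adj (B G) (u , i) (v , not i) ≡ adj G u v
  adj-B-opposite u v i = trans (cong (adj G u v ∧_) (xor-inverseʳ i)) (∧-identityʳ _)

  Adj-lift : ∀ {u v} i → Adj G u v → Adj (B G) (u , i) (v , not i)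
  Adj-lift {u} {v} i u~v = trans (adj-B-opposite u v i) u~v

  lift : Aut G × Bool → Aut (B G)
  fun   (lift (σ , a)) (u , i) = fun σ u , a xor i
  inv   (lift (σ , a)) (u , i) = inv σ u , a xor i
  inv-l (lift (σ , a)) (u , i) = cong₂ _,_ (inv-l σ u) (xor-cancelˡ a i)
  inv-r (lift (σ , a)) (u , i) = cong₂ _,_ (inv-r σ u) (xor-cancelˡ a i)
  pres  (lift (σ , a)) (u , i) (v , j) = cong₂ _∧_ (pres σ u v) (xor-cancel-common a i j)

  lift-cong : ∀ {p q} → p ≈P q → lift p ≈A lift q
  lift-cong (σ≈τ , refl) (u , i) = cong (_, _) (σ≈τ u)

  lift-injective : V → ∀ {p q} → lift p ≈A lift q → p ≈P q
  lift-injective v₀ {σ , a} {τ , b} lp≈lq =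
      (λ u → cong proj₁ (lp≈lq (u , false)))
    , (begin
        a           ≡⟨ sym (xor-identityʳ a) ⟩
        a xor false ≡⟨ cong proj₂ (lp≈lq (v₀ , false)) ⟩
        b xor false ≡⟨ xor-identityʳ b ⟩
        b           ∎)

  lift-·P : ∀ p q → lift (p ·P q) ≈A (lift p ∘A lift q)
  lift-·P (σ , a) (τ , b) (u , i) = cong (_ ,_) (xor-assoc a b i)

  every-automorphism-lifts⇒stable : V → (Φ : Aut (B G) → Aut G × Bool) →
                                    (∀ α → α ≈A lift (Φ α)) → Stable G
  every-automorphism-lifts⇒stable v₀ Φ α≈liftΦα =
      Φ
    , (λ α β α≈β → lift-injective v₀ {Φ α} {Φ β} λ x →
         trans (sym (α≈liftΦα α x)) (trans (α≈β x) (α≈liftΦα β x)))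
    , (λ α β → lift-injective v₀ {Φ (α ∘A β)} {Φ α ·P Φ β} λ x → begin
         fun (lift (Φ (α ∘A β))) x             ≡⟨ sym (α≈liftΦα (α ∘A β) x) ⟩
         fun (α ∘A β) x
           ≡⟨ ∘A-cong {α = α} {lift (Φ α)} {β} {lift (Φ β)} (α≈liftΦα α) (α≈liftΦα β) x ⟩
         fun (lift (Φ α) ∘A lift (Φ β)) x      ≡⟨ sym (lift-·P (Φ α) (Φ β) x) ⟩
         fun (lift (Φ α ·P Φ β)) x             ∎)
    , (λ α β Φα≈Φβ x →
         trans (α≈liftΦα α x) (trans (lift-cong {Φ α} {Φ β} Φα≈Φβ x) (sym (α≈liftΦα β x))))
    , (λ p → lift p , lift-injective v₀ {Φ (lift p)} {p} (λ x → sym (α≈liftΦα (lift p) x)))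

  layer-shift : Aut (B G) → V × Bool → Bool
  layer-shift α (u , i) = i xor proj₂ (fun α (u , i))

  layer-shift-edge : ∀ α x y → Adj (B G) x y → layer-shift α x ≡ layer-shift α y
  layer-shift-edge α (u , i) (v , j) x~y = begin
    i xor proj₂ (fun α (u , i))               ≡⟨ sym (xor-annihilates-not i _) ⟩
    not i xor not (proj₂ (fun α (u , i)))     ≡⟨ cong₂ _xor_ (sym j≡not-i) (sym αy≡not-αx) ⟩
    j xor proj₂ (fun α (v , j))               ∎
    where
      j≡not-i = xor≡true⇒≡not i j (∧-conicalʳ _ _ x~y)
      αy≡not-αx = xor≡true⇒≡not _ _ (∧-conicalʳ _ _ (trans (pres α _ _) x~y))

  layer-shift-constant : HasDiameter G 2 → TriangleFree G → ¬ Bipartite G →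
                         ∀ α x y → layer-shift α x ≡ layer-shift α y
  layer-shift-constant diam tf nbip α x y =
    let (u , x≡u) = to-layer₀ x
        (v , y≡v) = to-layer₀ y
    in trans x≡u (trans (constant-on-layer₀ u v) (sym y≡v))
    where
      c : V → Bool
      c u = layer-shift α (u , false)

      constant-on-layer₀ : ∀ u v → c u ≡ c v
      constant-on-layer₀ = nonEdge-invariant⇒constant tf nbip c λ u v u≢v u≁v →
        let (w , u~w , w~v) = common-neighbour (proj₁ diam) u≢v u≁v
        in trans (layer-shift-edge α (u , false) (w , true) (Adj-lift false u~w))
                 (sym (layer-shift-edge α (v , false) (w , true) (Adj-lift false (Adj-sym w~v))))

      to-layer₀ : ∀ x → ∃[ u ] layer-shift α x ≡ c u
      to-layer₀ (u , false) = u , refl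
      to-layer₀ (u , true) =
        let (v , u~v) = has-neighbour diam u
        in v , layer-shift-edge α (u , true) (v , false) (Adj-lift true u~v)

module LayerUniform {V : Set} {G : Graph V} (α : Aut (B G)) (a : Bool)
                    (layer : ∀ u i → proj₂ (fun α (u , i)) ≡ a xor i) where

  σ : Bool → V → V
  σ i u = proj₁ (fun α (u , i))

  τ : Bool → V → V
  τ i v = proj₁ (inv α (v , a xor i))

  fun-α : ∀ u i → fun α (u , i) ≡ (σ i u , a xor i)
  fun-α u i = cong (σ i u ,_) (layer u i)

  inv-α-layer : ∀ v i → proj₂ (inv α (v , a xor i)) ≡ i
  inv-α-layer v i = begin
    j                      ≡⟨ sym (xor-cancelˡ a j) ⟩
    a xor (a xor j)        ≡⟨ cong (a xor_) (sym (layer _ j)) ⟩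
    a xor proj₂ (fun α w)  ≡⟨ cong (λ y → a xor proj₂ y) (inv-r α (v , a xor i)) ⟩
    a xor (a xor i)        ≡⟨ xor-cancelˡ a i ⟩
    i                      ∎
    where
      w = inv α (v , a xor i)
      j = proj₂ w

  σ∘τ : ∀ i v → σ i (τ i v) ≡ v
  σ∘τ i v = begin
    proj₁ (fun α (proj₁ w , i))  ≡⟨ cong (λ j → proj₁ (fun α (proj₁ w , j))) (sym (inv-α-layer v i)) ⟩
    proj₁ (fun α w)              ≡⟨ cong proj₁ (inv-r α (v , a xor i)) ⟩
    v                            ∎
    where w = inv α (v , a xor i)

  τ∘σ : ∀ i u → τ i (σ i u) ≡ u
  τ∘σ i u = cong proj₁ (trans (cong (inv α) (sym (fun-α u i))) (inv-l α (u , i)))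

  σ-injective : ∀ i {u v} → σ i u ≡ σ i v → u ≡ v
  σ-injective i {u} {v} σu≡σv = trans (sym (τ∘σ i u)) (trans (cong (τ i) σu≡σv) (τ∘σ i v))

  adj-σ-opposite : ∀ i u v → adj G (σ i u) (σ (not i) v) ≡ adj G u v
  adj-σ-opposite i u v = begin
    adj G (σ i u) (σ (not i) v)                          ≡⟨ sym (adj-B-opposite {G = G} _ _ (a xor i)) ⟩
    adj (B G) (σ i u , a xor i) (σ (not i) v , not (a xor i))
      ≡⟨ cong₂ (adj (B G)) (sym (fun-α u i))
                           (trans (cong (σ (not i) v ,_) (not-distribʳ-xor a i)) (sym (fun-α v (not i)))) ⟩
    adj (B G) (fun α (u , i)) (fun α (v , not i))        ≡⟨ pres α _ _ ⟩
    adj (B G) (u , i) (v , not i)                         ≡⟨ adj-B-opposite {G = G} u v i ⟩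
    adj G u v                                             ∎

  -- Each σ i is an automorphism of Γ: an edge or non-edge it failed to preserve
  -- would give two vertices with a common neighbour on the other layer, i.e. a triangle.
  adj-σ : (∀ u v → DistLe G u v 2) → TriangleFree G →
          ∀ i u v → adj G (σ i u) (σ i v) ≡ adj G u v
  adj-σ dist≤2 tf i u v with adj G u v in u~v | adj G (σ i u) (σ i v) in σu~σv
  ... | true  | true  = refl
  ... | false | false = refl
  ... | true  | false =
    let (w , σu~w , w~σv) = common-neighbour dist≤2 σu≢σv σu~σv
        y = τ (not i) w
        u~y = trans (sym (adj-σ-opposite i u y))
                    (trans (cong (adj G (σ i u)) (σ∘τ (not i) w)) σu~w)
        v~y = trans (sym (adj-σ-opposite i v y))
                    (trans (cong (adj G (σ i v)) (σ∘τ (not i) w)) (Adj-sym {G = G} w~σv))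
    in ⊥-elim (tf u v y u~v v~y u~y)
    where
      σu≢σv : σ i u ≢ σ i v
      σu≢σv σu≡σv with σ-injective i σu≡σv
      ... | refl with trans (sym u~v) (adj-irrefl G u)
      ...   | ()
  ... | false | true =
    let (y , u~y , y~v) = common-neighbour dist≤2 u≢v u~v
    in ⊥-elim (tf (σ i u) (σ i v) (σ (not i) y) σu~σv
                  (trans (adj-σ-opposite i v y) (Adj-sym {G = G} y~v))
                  (trans (adj-σ-opposite i u y) u~y))
    where
      u≢v : u ≢ v
      u≢v refl with trans (sym σu~σv) (adj-irrefl G (σ i u))
      ... | ()

  -- N(σ false u) = σ false (N u) = N(σ true u).
  σ-layer-independent : (∀ u v → DistLe G u v 2) → TriangleFree G → Reduced G →
                        ∀ u → σ false u ≡ σ true u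
  σ-layer-independent dist≤2 tf red u = red _ _ λ w → begin
    adj G (σ false u) w                          ≡⟨ cong (adj G (σ false u)) (sym (σ∘τ false w)) ⟩
    adj G (σ false u) (σ false (τ false w))      ≡⟨ adj-σ dist≤2 tf false u (τ false w) ⟩
    adj G u (τ false w)                          ≡⟨ sym (adj-σ-opposite true u (τ false w)) ⟩
    adj G (σ true u) (σ false (τ false w))       ≡⟨ cong (adj G (σ true u)) (σ∘τ false w) ⟩
    adj G (σ true u) w                           ∎

  σ-automorphism : (∀ u v → DistLe G u v 2) → TriangleFree G → Bool → Aut G
  fun   (σ-automorphism _      _  i) = σ i
  inv   (σ-automorphism _      _  i) = τ i
  inv-l (σ-automorphism _      _  i) = τ∘σ i
  inv-r (σ-automorphism _      _  i) = σ∘τ i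
  pres  (σ-automorphism dist≤2 tf i) = adj-σ dist≤2 tf i

module Decomposition {V : Set} {G : Graph V} (red : Reduced G) (nbip : ¬ Bipartite G)
                     (diam : HasDiameter G 2) (tf : TriangleFree G) where

  base : V
  base = proj₁ (proj₂ diam)

  shift-bit : Aut (B G) → Bool
  shift-bit α = layer-shift α (base , false)

  layer : ∀ α u i → proj₂ (fun α (u , i)) ≡ shift-bit α xor i
  layer α u i = begin
    proj₂ (fun α (u , i))                ≡⟨ sym (xor-cancelˡ i _) ⟩
    i xor (i xor proj₂ (fun α (u , i)))
      ≡⟨ cong (i xor_) (layer-shift-constant diam tf nbip α (u , i) (base , false)) ⟩
    i xor shift-bit α                    ≡⟨ xor-comm i _ ⟩
    shift-bit α xor i                    ∎

  decompose : Aut (B G) → Aut G × Bool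
  decompose α = σ-automorphism (proj₁ diam) tf false , shift-bit α
    where open LayerUniform α (shift-bit α) (layer α)

  decompose-lifts : ∀ α → α ≈A lift (decompose α)
  decompose-lifts α (u , i) = trans (fun-α u i) (cong (_, shift-bit α xor i) (σ≡σ-false i))
    where
      open LayerUniform α (shift-bit α) (layer α)
      σ≡σ-false : ∀ i → σ i u ≡ σ false u
      σ≡σ-false false = refl
      σ≡σ-false true  = sym (σ-layer-independent (proj₁ diam) tf red u)

theorem3p4 : (n : ℕ) (Γ : Graph (Fin n)) → Reduced Γ → ¬ Bipartite Γ
           → HasDiameter Γ 2 → TriangleFree Γ → Stable Γ
theorem3p4 n Γ red nbip diam tf =
  every-automorphism-lifts⇒stable base decompose decompose-lifts
  where open Decomposition red nbip diam tf
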